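{- Let $m \ge 4$ be an integer. Then \[ R(F_n, F_m) \ge \begin{cases} 4n + m/2, & \text{for } m \le n \le 5m/4 - 1;\\ 2n + 3m - 2, & \text{for } 5m/4 - 1 < n \le 3m/2 - 2. \end{cases} \] In particular, $R(F_n, F_n) \ge \lceil 9n/2 \rceil$ for all $n \ge 4$.
   Context: For graphs $G_1,G_2$, the Ramsey number $R(G_1,G_2)$ is the smallest positive integer $N$ such that every red-blue edge-coloring of $K_N$ contains a red copy of $G_1$ or a blue copy of $G_2$. For a graph $G$, $K_1+G$ denotes the graph obtained by adding a new vertex adjacent to every vertex of $G$. The fan $F_n$ is $K_1+nK_2$, where $nK_2$ is a matching of $n$ edges (so $F_n$ has $2n+1$ vertices). -}

module Defs where

open import Data.Nat using (ℕ; zero; suc; _+_; _*_; _<_; _≤_)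
open import Data.Fin using (Fin; toℕ)
open import Data.Product using (Σ; _×_; ∃-syntax)
open import Data.Sum using (_⊎_)
open import Relation.Binary.PropositionalEquality using (_≡_; _≢_)
open import Relation.Nullary using (¬_)
open import Function.Definitions using (Injective)

record Graph : Set₁ where
  field
    V   : ℕ
    Adj : Fin V → Fin V → Set
open Graph public

data Colour : Set where
  red blue : Colour

-- A red-blue edge-colouring of K_N: a symmetric colour assignment to pairs
-- of distinct vertices (values on the diagonal are irrelevant).
Colouring : ℕ → Set
Colouring N = Fin N → Fin N → Colour

Symmetric : ∀ {N} → Colouring N → Set
Symmetric {N} c = (x y : Fin N) → c x y ≡ c y x

HasCopy : ∀ {N} → Colouring N → Colour → Graph → Set
HasCopy {N} c col G =
  Σ (Fin (V G) → Fin N) λ f →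
    Injective _≡_ _≡_ f × ((x y : Fin (V G)) → Adj G x y → c (f x) (f y) ≡ col)

Arrows : ℕ → Graph → Graph → Set
Arrows N G₁ G₂ = (c : Colouring N) → Symmetric c → HasCopy c red G₁ ⊎ HasCopy c blue G₂

IsRamseyNumber : Graph → Graph → ℕ → Set
IsRamseyNumber G₁ G₂ r =
  1 ≤ r × Arrows r G₁ G₂ × ((k : ℕ) → 1 ≤ k → k < r → ¬ Arrows k G₁ G₂)

-- Fan F_n = K_1 + nK_2 on vertices 0,1,...,2n: centre 0, matching edges {2i+1, 2i+2}.
MatchEdge : ℕ → ℕ → Set
MatchEdge a b = ∃[ i ] (a ≡ 1 + 2 * i × b ≡ 2 + 2 * i)

FanAdj : ∀ {k} → Fin k → Fin k → Set
FanAdj x y =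
  ((toℕ x ≡ 0 × toℕ y ≢ 0) ⊎ (toℕ y ≡ 0 × toℕ x ≢ 0))
  ⊎ (MatchEdge (toℕ x) (toℕ y) ⊎ MatchEdge (toℕ y) (toℕ x))

Fan : ℕ → Graph
Fan n = record { V = suc (n + n) ; Adj = FanAdj }

-- The bounds come from a single blow-up colouring. Take blocks E, A, B, C, D of sizes
-- 2n, a = b + d = m - 1, b, c, d, where b and d are the two halves of m - 1. E is a red
-- clique joined in blue to everything else; on A ∪ B ∪ C ∪ D red is the blow-up of the
-- 4-cycle A B D C, so A–D and B–C are blue. Every red closed neighbourhood is E or three of
-- A, B, C, D, of size at most 2n, so there is no red F_n. The only blue triangles of blocks
-- are E A D and E B C, so every blue triangle through a vertex of block β meets a fixed set
-- of at most m - 1 vertices (B ∪ D for β = E, the opposite block otherwise); the m triangles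
-- of a blue F_m meet only in the centre, so there is no blue F_m either. Taking
-- c = 2n - a - d, resp. c = a, gives such colourings of K_N for N = 4n + b, resp.
-- N = 2n + 3m - 3.

module Submission where

open import Defs
open import Data.Nat using (ℕ; _+_; _*_; _∸_; _≤_; _<_)
open import Data.Product using (_×_)

open import Data.Bool using (Bool; true; false; T; not; _∨_; if_then_else_)
open import Data.Bool.Properties using (∨-comm)
open import Data.Empty using (⊥-elim)
open import Data.Fin using (Fin; zero; suc; toℕ; splitAt; join; cast; combine; inject≤)
open import Data.Fin.Properties
  using (splitAt-join; join-splitAt; toℕ-cast; toℕ-combine; combine-injectiveˡ; inject≤-injective;
         injective⇒≤; toℕ-injective; suc-injective)
open import Data.List using (List; []; _∷_; map)
open import Data.Nat.ListAction using (sum)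
open import Data.Nat using (suc; s≤s; ⌊_/2⌋; ⌈_/2⌉)
open import Data.Nat.Properties hiding (suc-injective)
open import Data.Nat.Tactic.RingSolver using (solve; solve-∀)
open import Data.Product using (Σ; _,_; proj₁; proj₂)
open import Data.Sum using (_⊎_; inj₁; inj₂; [_,_]′)
import Data.Sum as Sum
open import Data.Sum.Properties using (inj₁-injective; inj₂-injective)
open import Function using (_∘_; const)
open import Function.Definitions using (Injective)
open import Relation.Binary.PropositionalEquality
  using (_≡_; refl; sym; trans; cong; subst; module ≡-Reasoning)
open import Relation.Nullary using (¬_)

AtMost : {X : Set} → ℕ → (X → Set) → Set
AtMost {X} k P =
  Σ ((x : X) → P x → Fin k) λ code → ∀ {x y} px py → code x px ≡ code y py → x ≡ y

module _ {X : Set} {P : X → Set} where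

  AtMost⇒≤ : ∀ {k K} → AtMost k P →
             (f : Fin K → X) → Injective _≡_ _≡_ f → (∀ i → P (f i)) → K ≤ k
  AtMost⇒≤ (code , code-inj) f f-inj Pf =
    injective⇒≤ λ eq → f-inj (code-inj (Pf _) (Pf _) eq)

  AtMost-⊆ : ∀ {Q : X → Set} {k} → (∀ {x} → P x → Q x) → AtMost k Q → AtMost k P
  AtMost-⊆ P⊆Q (code , code-inj) =
    (λ x px → code x (P⊆Q px)) , λ px py → code-inj (P⊆Q px) (P⊆Q py)

  AtMost-≤ : ∀ {k l} → k ≤ l → AtMost k P → AtMost l P
  AtMost-≤ k≤l (code , code-inj) =
    (λ x px → inject≤ (code x px) k≤l) ,
    λ px py eq → code-inj px py (inject≤-injective k≤l k≤l _ _ eq)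

  AtMost-∅ : (∀ {x} → ¬ P x) → AtMost 0 P
  AtMost-∅ ¬P = (λ _ px → ⊥-elim (¬P px)) , λ px → ⊥-elim (¬P px)

  AtMost-preimage : ∀ {Y : Set} {g : Y → X} {k} →
                    Injective _≡_ _≡_ g → AtMost k P → AtMost k (P ∘ g)
  AtMost-preimage {g = g} g-inj (code , code-inj) =
    (λ y → code (g y)) , λ py py′ eq → g-inj (code-inj py py′ eq)

AtMost-Fin : ∀ {k} {P : Fin k → Set} → AtMost k P
AtMost-Fin = (λ x _ → x) , λ _ _ eq → eq

join-injective : ∀ m n → Injective _≡_ _≡_ (join m n)
join-injective m n {u} {v} eq = begin
  u                      ≡⟨ splitAt-join m n u ⟨
  splitAt m (join m n u) ≡⟨ cong (splitAt m) eq ⟩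
  splitAt m (join m n v) ≡⟨ splitAt-join m n v ⟩
  v                      ∎
  where open ≡-Reasoning

splitAt-injective : ∀ m {n} → Injective _≡_ _≡_ (splitAt m {n})
splitAt-injective m {n} {u} {v} eq = begin
  u                      ≡⟨ join-splitAt m n u ⟨
  join m n (splitAt m u) ≡⟨ cong (join m n) eq ⟩
  join m n (splitAt m v) ≡⟨ join-splitAt m n v ⟩
  v                      ∎
  where open ≡-Reasoning

AtMost-⊎ : ∀ {X Y : Set} {P : X ⊎ Y → Set} {k l} →
           AtMost k (P ∘ inj₁) → AtMost l (P ∘ inj₂) → AtMost (k + l) P
AtMost-⊎ {P = P} {k} {l} (code₁ , code₁-inj) (code₂ , code₂-inj) = code , code-inj
  where
  code : ∀ z → P z → Fin (k + l)
  code (inj₁ x) px = join k l (inj₁ (code₁ x px))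
  code (inj₂ y) py = join k l (inj₂ (code₂ y py))

  code-inj : ∀ {z w} pz pw → code z pz ≡ code w pw → z ≡ w
  code-inj {inj₁ x} {inj₁ x′} px px′ eq =
    cong inj₁ (code₁-inj px px′ (inj₁-injective (join-injective k l eq)))
  code-inj {inj₂ y} {inj₂ y′} py py′ eq =
    cong inj₂ (code₂-inj py py′ (inj₂-injective (join-injective k l eq)))
  code-inj {inj₁ x} {inj₂ y} px py eq
    with () ← join-injective k l {inj₁ (code₁ x px)} {inj₂ (code₂ y py)} eq
  code-inj {inj₂ y} {inj₁ x} py px eq
    with () ← join-injective k l {inj₂ (code₂ y py)} {inj₁ (code₁ x px)} eq

endpoint : ∀ {n} → Fin n → Fin 2 → Fin (suc (n + n))
endpoint {n} i j = suc (cast (trans (*-comm n 2) (cong (n +_) (+-identityʳ n))) (combine i j))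

toℕ-endpoint : ∀ {n} (i : Fin n) j → toℕ (endpoint i j) ≡ suc (2 * toℕ i + toℕ j)
toℕ-endpoint i j = cong suc (trans (toℕ-cast _ (combine i j)) (toℕ-combine i j))

endpoint-injectiveˡ : ∀ {n} (i : Fin n) j i′ j′ → endpoint i j ≡ endpoint i′ j′ → i ≡ i′
endpoint-injectiveˡ i j i′ j′ eq = combine-injectiveˡ i j i′ j′ (toℕ-injective (begin
  toℕ (combine i j)            ≡⟨ toℕ-cast _ (combine i j) ⟨
  toℕ (cast _ (combine i j))   ≡⟨ cong toℕ (suc-injective eq) ⟩
  toℕ (cast _ (combine i′ j′)) ≡⟨ toℕ-cast _ (combine i′ j′) ⟩
  toℕ (combine i′ j′)          ∎))
  where open ≡-Reasoning

Fan-spoke : ∀ {n} (j : Fin (n + n)) → Adj (Fan n) zero (suc j)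
Fan-spoke j = inj₁ (inj₁ (refl , λ ()))

Fan-rim : ∀ {n} (i : Fin n) → Adj (Fan n) (endpoint i zero) (endpoint i (suc zero))
Fan-rim i = inj₂ (inj₁ (toℕ i ,
  trans (toℕ-endpoint i zero) (cong suc (+-identityʳ _)) ,
  trans (toℕ-endpoint i (suc zero)) (cong suc (+-comm _ 1))))

module _ {N} (c : Colouring N) (col : Colour) where

  no-Fan-by-degree : ∀ {n} → (∀ v → AtMost (n + n) (λ w → w ≡ v ⊎ c v w ≡ col)) →
                     ¬ HasCopy c col (Fan n)
  no-Fan-by-degree {n} small (f , f-inj , f-col) =
    1+n≰n (AtMost⇒≤ (small (f zero)) f f-inj inClosedNeighbourhood)
    where
    inClosedNeighbourhood : ∀ x → f x ≡ f zero ⊎ c (f zero) (f x) ≡ col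
    inClosedNeighbourhood zero    = inj₁ refl
    inClosedNeighbourhood (suc j) = inj₂ (f-col zero (suc j) (Fan-spoke {n} j))

  -- The m triangles of a fan centred at v have disjoint rims, each meeting Q v.
  no-Fan-by-cover : ∀ {m k} (Q : Fin N → Fin N → Set) → (∀ v → AtMost k (Q v)) → k < m →
                    (∀ v x y → c v x ≡ col → c v y ≡ col → c x y ≡ col → Q v x ⊎ Q v y) →
                    ¬ HasCopy c col (Fan m)
  no-Fan-by-cover {m} Q small k<m covers (f , f-inj , f-col) =
    <⇒≱ k<m (AtMost⇒≤ (small v) g g-inj (proj₂ ∘ side))
    where
    v = f zero

    side : ∀ i → Σ (Fin 2) λ j → Q v (f (endpoint i j))
    side i = [ (zero ,_) , (suc zero ,_) ]′
      (covers v _ _ (f-col zero _ (Fan-spoke {m} _)) (f-col zero _ (Fan-spoke {m} _))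
                    (f-col _ _ (Fan-rim i)))

    g : Fin _ → Fin N
    g i = f (endpoint i (proj₁ (side i)))

    g-inj : Injective _≡_ _≡_ g
    g-inj eq = endpoint-injectiveˡ _ _ _ _ (f-inj eq)

module BlowUp {Block : Set} (size : Block → ℕ) where

  order : List Block → ℕ
  order bs = sum (map size bs)

  blockOf : (bs : List Block) → Fin (order bs) → Block
  blockOf (β ∷ bs) = [ const β , blockOf bs ]′ ∘ splitAt (size β)

  sizeWhere : (Block → Bool) → List Block → ℕ
  sizeWhere p []       = 0
  sizeWhere p (β ∷ bs) = (if p β then size β else 0) + sizeWhere p bs

  sizeWhere-AtMost : ∀ p bs → AtMost (sizeWhere p bs) (T ∘ p ∘ blockOf bs)
  sizeWhere-AtMost p []       = AtMost-Fin
  sizeWhere-AtMost p (β ∷ bs) =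
    AtMost-preimage (splitAt-injective (size β))
      (AtMost-⊎ {P = T ∘ p ∘ [ const β , blockOf bs ]′} first (sizeWhere-AtMost p bs))
    where
    first : AtMost (if p β then size β else 0) (λ (_ : Fin (size β)) → T (p β))
    first with p β
    ... | true  = AtMost-Fin
    ... | false = AtMost-∅ λ ()

  blowUp : (Block → Block → Colour) → (bs : List Block) → Colouring (order bs)
  blowUp κ bs x y = κ (blockOf bs x) (blockOf bs y)

data Block : Set where
  E A B C D : Block

-- One orientation of each blue pair; bluePair symmetrises it, so symmetry comes for free.
arc : Block → Block → Bool
arc E E = false
arc E _ = true
arc A D = true
arc B C = true
arc _ _ = false

bluePair : Block → Block → Bool
bluePair β γ = arc β γ ∨ arc γ β

blockColour : Block → Block → Colour
blockColour β γ = if bluePair β γ then blue else red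

blockColour-sym : ∀ β γ → blockColour β γ ≡ blockColour γ β
blockColour-sym β γ = cong (if_then blue else red) (∨-comm (arc β γ) (arc γ β))

¬bluePair-refl : ∀ β → T (not (bluePair β β))
¬bluePair-refl E = _
¬bluePair-refl A = _
¬bluePair-refl B = _
¬bluePair-refl C = _
¬bluePair-refl D = _

red⇒¬bluePair : ∀ β γ → blockColour β γ ≡ red → T (not (bluePair β γ))
red⇒¬bluePair β γ eq with bluePair β γ
... | false = _

-- The blue triangles are E A D and E B C; cover β picks a block other than β
-- from each one through β.
cover : Block → Block → Bool
cover E B = true
cover E D = true
cover A D = true
cover B C = true
cover C B = true
cover D A = true
cover _ _ = false

blueTriangle-cover : ∀ β γ δ →
  blockColour β γ ≡ blue → blockColour β δ ≡ blue → blockColour γ δ ≡ blue →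
  T (cover β γ) ⊎ T (cover β δ)
blueTriangle-cover E B _ _ _ _ = inj₁ _
blueTriangle-cover E D _ _ _ _ = inj₁ _
blueTriangle-cover E _ B _ _ _ = inj₂ _
blueTriangle-cover E _ D _ _ _ = inj₂ _
blueTriangle-cover E E _ () _ _
blueTriangle-cover E _ E _ () _
blueTriangle-cover E A A _ _ ()
blueTriangle-cover E A C _ _ ()
blueTriangle-cover E C A _ _ ()
blueTriangle-cover E C C _ _ ()
blueTriangle-cover A D _ _ _ _ = inj₁ _
blueTriangle-cover A _ D _ _ _ = inj₂ _
blueTriangle-cover A A _ () _ _
blueTriangle-cover A B _ () _ _
blueTriangle-cover A C _ () _ _
blueTriangle-cover A E A _ () _
blueTriangle-cover A E B _ () _
blueTriangle-cover A E C _ () _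
blueTriangle-cover A E E _ _ ()
blueTriangle-cover B C _ _ _ _ = inj₁ _
blueTriangle-cover B _ C _ _ _ = inj₂ _
blueTriangle-cover B A _ () _ _
blueTriangle-cover B B _ () _ _
blueTriangle-cover B D _ () _ _
blueTriangle-cover B E A _ () _
blueTriangle-cover B E B _ () _
blueTriangle-cover B E D _ () _
blueTriangle-cover B E E _ _ ()
blueTriangle-cover C B _ _ _ _ = inj₁ _
blueTriangle-cover C _ B _ _ _ = inj₂ _
blueTriangle-cover C A _ () _ _
blueTriangle-cover C C _ () _ _
blueTriangle-cover C D _ () _ _
blueTriangle-cover C E A _ () _
blueTriangle-cover C E C _ () _
blueTriangle-cover C E D _ () _
blueTriangle-cover C E E _ _ ()
blueTriangle-cover D A _ _ _ _ = inj₁ _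
blueTriangle-cover D _ A _ _ _ = inj₂ _
blueTriangle-cover D B _ () _ _
blueTriangle-cover D C _ () _ _
blueTriangle-cover D D _ () _ _
blueTriangle-cover D E B _ () _
blueTriangle-cover D E C _ () _
blueTriangle-cover D E D _ () _
blueTriangle-cover D E E _ _ ()

module Construction (size : Block → ℕ) where

  open BlowUp size public

  blocks : List Block
  blocks = E ∷ A ∷ B ∷ C ∷ D ∷ []

  colouring : Colouring (order blocks)
  colouring = blowUp blockColour blocks

  colouring-symmetric : Symmetric colouring
  colouring-symmetric x y = blockColour-sym (blockOf blocks x) (blockOf blocks y)

  no-red-Fan : ∀ {n} → (∀ β → sizeWhere (not ∘ bluePair β) blocks ≤ n + n) →
               ¬ HasCopy colouring red (Fan n)
  no-red-Fan {n} small = no-Fan-by-degree colouring red {n} λ v →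
    AtMost-≤ (small (blockOf blocks v))
      (AtMost-⊆ (inRedBlock v) (sizeWhere-AtMost (not ∘ bluePair (blockOf blocks v)) blocks))
    where
    inRedBlock : ∀ v {w} → w ≡ v ⊎ colouring v w ≡ red →
                 T (not (bluePair (blockOf blocks v) (blockOf blocks w)))
    inRedBlock v (inj₁ refl) = ¬bluePair-refl (blockOf blocks v)
    inRedBlock v {w} (inj₂ eq) = red⇒¬bluePair (blockOf blocks v) (blockOf blocks w) eq

  no-blue-Fan : ∀ {m k} → (∀ β → sizeWhere (cover β) blocks ≤ k) → k < m →
                ¬ HasCopy colouring blue (Fan m)
  no-blue-Fan {m} small k<m = no-Fan-by-cover colouring blue {m}
    (λ v w → T (cover (blockOf blocks v) (blockOf blocks w)))
    (λ v → AtMost-≤ (small (blockOf blocks v))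
                    (sizeWhere-AtMost (cover (blockOf blocks v)) blocks))
    k<m
    (λ v x y → blueTriangle-cover (blockOf blocks v) (blockOf blocks x) (blockOf blocks y))

blockSizes : (n b c d : ℕ) → Block → ℕ
blockSizes n b c d E = n + n
blockSizes n b c d A = b + d
blockSizes n b c d B = b
blockSizes n b c d C = c
blockSizes n b c d D = d

construction-¬arrows : ∀ {n b c d} → b ≤ d → c ≤ b + d →
  (b + d) + (b + d) ≤ n + n → (b + d) + (c + d) ≤ n + n →
  ¬ Arrows (n + n + 2 * (b + d) + c) (Fan n) (Fan (suc (b + d)))
construction-¬arrows {n} {b} {c} {d} b≤d c≤b+d 2a≤2n a+c+d≤2n arrows =
  [ no-red-Fan {n} redBound , no-blue-Fan blueBound ≤-refl ]′
    (arrows′ colouring colouring-symmetric)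
  where
  open Construction (blockSizes n b c d)

  order-blocks : n + n + (b + d + (b + (c + (d + 0)))) ≡ n + n + 2 * (b + d) + c
  order-blocks = solve (n ∷ b ∷ c ∷ d ∷ [])

  arrows′ : Arrows (order blocks) (Fan n) (Fan (suc (b + d)))
  arrows′ = subst (λ N → Arrows N (Fan n) (Fan (suc (b + d)))) (sym order-blocks) arrows

  redBound : ∀ β → sizeWhere (not ∘ bluePair β) blocks ≤ n + n
  redBound E = ≤-reflexive (+-identityʳ (n + n))
  redBound A = begin
    b + d + (b + (c + 0)) ≤⟨ +-monoʳ-≤ (b + d) (+-mono-≤ b≤d (≤-reflexive (+-identityʳ c))) ⟩
    b + d + (d + c)       ≡⟨ cong (b + d +_) (+-comm d c) ⟩
    b + d + (c + d)       ≤⟨ a+c+d≤2n ⟩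
    n + n                 ∎
    where open ≤-Reasoning
  redBound B = ≤-trans (≤-reflexive (cong (λ x → b + d + (b + x)) (+-identityʳ d))) 2a≤2n
  redBound C = ≤-trans (≤-reflexive (cong (λ x → b + d + (c + x)) (+-identityʳ d))) a+c+d≤2n
  redBound D =
    ≤-trans (+-mono-≤ (m≤m+n b d) (≤-reflexive (cong (c +_) (+-identityʳ d)))) a+c+d≤2n

  blueBound : ∀ β → sizeWhere (cover β) blocks ≤ b + d
  blueBound E = ≤-reflexive (cong (b +_) (+-identityʳ d))
  blueBound A = ≤-trans (≤-reflexive (+-identityʳ d)) (m≤n+m d b)
  blueBound B = ≤-trans (≤-reflexive (+-identityʳ c)) c≤b+d
  blueBound C = ≤-trans (≤-reflexive (+-identityʳ b)) (m≤m+n b d)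
  blueBound D = ≤-reflexive (+-identityʳ (b + d))

Arrows-mono : ∀ {M N G H} → M ≤ N → Arrows M G H → Arrows N G H
Arrows-mono {M} {N} M≤N arrows c c-sym =
  Sum.map restrictCopy restrictCopy
    (arrows (λ x y → c (ι x) (ι y)) (λ x y → c-sym (ι x) (ι y)))
  where
  ι : Fin M → Fin N
  ι x = inject≤ x M≤N

  restrictCopy : ∀ {col G} → HasCopy (λ x y → c (ι x) (ι y)) col G → HasCopy c col G
  restrictCopy (f , f-inj , f-col) =
    ι ∘ f , (λ eq → f-inj (inject≤-injective M≤N M≤N _ _ eq)) , f-col

¬Arrows⇒<RamseyNumber : ∀ {G H r M} → IsRamseyNumber G H r → ¬ Arrows M G H → M < r
¬Arrows⇒<RamseyNumber (_ , arrows , _) ¬arrows =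
  ≰⇒> λ r≤M → ¬arrows (Arrows-mono r≤M arrows)

2*m≤1+2*n⇒m≤n : ∀ {m n} → 2 * m ≤ suc (2 * n) → m ≤ n
2*m≤1+2*n⇒m≤n {m} {n} 2m≤1+2n =
  ≤-pred (*-cancelˡ-< 2 m (suc n) (subst (2 * m <_) (sym (*-suc 2 n)) (s≤s 2m≤1+2n)))

4n+4≤5m⇒2n≤2a+d : ∀ {n b d} → b ≤ d → 4 * n + 4 ≤ 5 * suc (b + d) →
                   n + n ≤ b + d + d + (b + d)
4n+4≤5m⇒2n≤2a+d {n} {b} {d} b≤d 4n+4≤5m = 2*m≤1+2*n⇒m≤n (begin
  2 * (n + n)                      ≡⟨ solve (n ∷ []) ⟩
  4 * n                            ≤⟨ +-cancelʳ-≤ 4 (4 * n) (suc (5 * (b + d)))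
                                        (≤-trans 4n+4≤5m (≤-reflexive (solve (b ∷ d ∷ [])))) ⟩
  suc (5 * (b + d))                ≡⟨ cong suc (solve (b ∷ d ∷ [])) ⟩
  suc (4 * (b + d) + (b + d))      ≤⟨ s≤s (+-monoʳ-≤ (4 * (b + d)) (+-monoˡ-≤ d b≤d)) ⟩
  suc (4 * (b + d) + (d + d))      ≡⟨ cong suc (solve (b ∷ d ∷ [])) ⟩
  suc (2 * (b + d + d + (b + d)))  ∎)
  where open ≤-Reasoning

5m<4n+4⇒3a+d≤2n : ∀ {n b d} → d ≤ suc b → 5 * suc (b + d) < 4 * n + 4 →
                   b + d + (b + d + d) ≤ n + n
5m<4n+4⇒3a+d≤2n {n} {b} {d} d≤1+b 5m<4n+4 =
  <⇒≤ (*-cancelˡ-< 2 (b + d + (b + d + d)) (n + n) (begin-strict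
    2 * (b + d + (b + d + d))      ≡⟨ solve (b ∷ d ∷ []) ⟩
    4 * (b + d) + (d + d)          ≤⟨ +-monoʳ-≤ (4 * (b + d)) (+-monoˡ-≤ d d≤1+b) ⟩
    4 * (b + d) + suc (b + d)      ≡⟨ solve (b ∷ d ∷ []) ⟩
    suc (5 * (b + d))              <⟨ +-cancelʳ-≤ 4 (suc (suc (5 * (b + d)))) (4 * n)
                                        (≤-trans (≤-reflexive 5a+6≡5m+1) 5m<4n+4) ⟩
    4 * n                          ≡⟨ solve (n ∷ []) ⟩
    2 * (n + n)                    ∎))
  where
  open ≤-Reasoning
  5a+6≡5m+1 : suc (suc (5 * (b + d))) + 4 ≡ suc (5 * suc (b + d))
  5a+6≡5m+1 = solve (b ∷ d ∷ [])

lowerBound-near : ∀ {m n r} b d → m ≡ suc (b + d) → b ≤ d → d ≤ suc b →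
  IsRamseyNumber (Fan n) (Fan m) r → m ≤ n → 4 * n + 4 ≤ 5 * m → 8 * n + m ≤ 2 * r
lowerBound-near {n = n} {r} b d refl b≤d d≤1+b ramsey m≤n 4n+4≤5m = begin
  8 * n + suc (b + d)                              ≤⟨ +-monoʳ-≤ (8 * n) 1+b+d≤2+2b ⟩
  8 * n + 2 * suc b                                ≡⟨ solve (n ∷ b ∷ []) ⟩
  2 * (n + n) + 2 * (n + n) + 2 * suc b
    ≡⟨ cong (λ x → 2 * (n + n) + 2 * x + 2 * suc b) c-eq ⟨
  2 * (n + n) + 2 * (b + d + d + c) + 2 * suc b    ≡⟨ regroup n b c d ⟩
  2 * suc (n + n + 2 * (b + d) + c)                ≤⟨ *-monoʳ-≤ 2 N<r ⟩
  2 * r                                            ∎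
  where
  open ≤-Reasoning

  a+d≤2n : b + d + d ≤ n + n
  a+d≤2n = +-mono-≤ (<⇒≤ m≤n) (≤-trans (m≤n+m d b) (<⇒≤ m≤n))

  c : ℕ
  c = proj₁ (m≤n⇒∃[o]m+o≡n a+d≤2n)

  c-eq : b + d + d + c ≡ n + n
  c-eq = proj₂ (m≤n⇒∃[o]m+o≡n a+d≤2n)

  c≤a : c ≤ b + d
  c≤a = +-cancelˡ-≤ (b + d + d) c (b + d)
          (subst (_≤ b + d + d + (b + d)) (sym c-eq) (4n+4≤5m⇒2n≤2a+d {n = n} b≤d 4n+4≤5m))

  2a≤2n : b + d + (b + d) ≤ n + n
  2a≤2n = +-mono-≤ (<⇒≤ m≤n) (<⇒≤ m≤n)

  a+c+d≡2n : b + d + (c + d) ≡ n + n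
  a+c+d≡2n = trans (trans (cong (b + d +_) (+-comm c d)) (sym (+-assoc (b + d) d c))) c-eq

  N<r : n + n + 2 * (b + d) + c < r
  N<r = ¬Arrows⇒<RamseyNumber ramsey
          (construction-¬arrows {n = n} b≤d c≤a 2a≤2n (≤-reflexive a+c+d≡2n))

  1+b+d≤2+2b : suc (b + d) ≤ 2 * suc b
  1+b+d≤2+2b = begin
    suc (b + d)     ≤⟨ s≤s (+-monoʳ-≤ b d≤1+b) ⟩
    suc (b + suc b) ≡⟨ solve (b ∷ []) ⟩
    2 * suc b       ∎

  regroup : ∀ n b c d →
            2 * (n + n) + 2 * (b + d + d + c) + 2 * suc b ≡ 2 * suc (n + n + 2 * (b + d) + c)
  regroup = solve-∀

lowerBound-far : ∀ {m n r} b d → m ≡ suc (b + d) → b ≤ d → d ≤ suc b →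
  IsRamseyNumber (Fan n) (Fan m) r → 5 * m < 4 * n + 4 → 2 * n + 3 * m ∸ 2 ≤ r
lowerBound-far {n = n} {r} b d refl b≤d d≤1+b ramsey 5m<4n+4 =
  subst (λ x → x ∸ 2 ≤ r) N+3≡2n+3m N<r
  where
  3a+d≤2n : b + d + (b + d + d) ≤ n + n
  3a+d≤2n = 5m<4n+4⇒3a+d≤2n {n = n} d≤1+b 5m<4n+4

  2a≤2n : b + d + (b + d) ≤ n + n
  2a≤2n = ≤-trans (+-monoʳ-≤ (b + d) (m≤m+n (b + d) d)) 3a+d≤2n

  N<r : suc (n + n + 2 * (b + d) + (b + d)) ≤ r
  N<r = ¬Arrows⇒<RamseyNumber ramsey
          (construction-¬arrows {n = n} b≤d ≤-refl 2a≤2n 3a+d≤2n)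

  N+3≡2n+3m : 2 + suc (n + n + 2 * (b + d) + (b + d)) ≡ 2 * n + 3 * suc (b + d)
  N+3≡2n+3m = solve (n ∷ b ∷ d ∷ [])

theorem3 :
    ((m n r : ℕ) → 4 ≤ m → IsRamseyNumber (Fan n) (Fan m) r →
        (m ≤ n → 4 * n + 4 ≤ 5 * m → 8 * n + m ≤ 2 * r)
      × (5 * m < 4 * n + 4 → 2 * n + 4 ≤ 3 * m → 2 * n + 3 * m ∸ 2 ≤ r))
    × ((n r : ℕ) → 4 ≤ n → IsRamseyNumber (Fan n) (Fan n) r → 9 * n ≤ 2 * r)
theorem3 = bounds , diagonal
  where
  bounds : (m n r : ℕ) → 4 ≤ m → IsRamseyNumber (Fan n) (Fan m) r →
             (m ≤ n → 4 * n + 4 ≤ 5 * m → 8 * n + m ≤ 2 * r)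
           × (5 * m < 4 * n + 4 → 2 * n + 4 ≤ 3 * m → 2 * n + 3 * m ∸ 2 ≤ r)
  bounds 0       _ _ () _
  bounds (suc k) n r _ ramsey =
    lowerBound-near {n = n} b d m≡1+b+d b≤d d≤1+b ramsey ,
    -- the construction needs no upper bound on n
    λ 5m<4n+4 _ → lowerBound-far {n = n} b d m≡1+b+d b≤d d≤1+b ramsey 5m<4n+4
    where
    b = ⌊ k /2⌋
    d = ⌈ k /2⌉
    m≡1+b+d : suc k ≡ suc (b + d)
    m≡1+b+d = cong suc (sym (⌊n/2⌋+⌈n/2⌉≡n k))
    b≤d : b ≤ d
    b≤d = ⌊n/2⌋≤⌈n/2⌉ k
    d≤1+b : d ≤ suc b
    d≤1+b = ⌊n/2⌋-mono (n≤1+n (suc k))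

  diagonal : (n r : ℕ) → 4 ≤ n → IsRamseyNumber (Fan n) (Fan n) r → 9 * n ≤ 2 * r
  diagonal n r 4≤n ramsey = begin
    9 * n     ≡⟨ solve (n ∷ []) ⟩
    8 * n + n ≤⟨ proj₁ (bounds n n r 4≤n ramsey) ≤-refl 4n+4≤5n ⟩
    2 * r     ∎
    where
    open ≤-Reasoning
    4n+4≤5n : 4 * n + 4 ≤ 5 * n
    4n+4≤5n = begin
      4 * n + 4 ≤⟨ +-monoʳ-≤ (4 * n) 4≤n ⟩
      4 * n + n ≡⟨ solve (n ∷ []) ⟩
      5 * n     ∎
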